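{- Let $p$ be a prime and $m$ a positive integer, and suppose that either $m$ is odd, or $m\equiv0\pmod4$ and $p\ne2$. Then every path $\gamma\in Y_m(p)$ has a subpath of one of the forms \[ \frac{a}{b}\to\frac{c}{1}\to\frac{ -1}{0}\qquad\text{or}\qquad \frac{a}{b}\to\frac{c}{ -1}\to\frac{1}{0}, \] where $a,b,c\in\mathbb{Z}/p\mathbb{Z}$ and $b\ne0$.
   Context: For a positive integer $n$, $\mathscr{E}_n$ is the directed graph whose vertices are the pairs $(a,b)$ with $a,b\in\mathbb{Z}/n\mathbb{Z}$ generating the unit ideal (i.e. $\gcd(a,b,n)=1$ for representatives), written $a/b$, with a directed edge $a/b\to c/d$ iff $ad-bc=1$ in $\mathbb{Z}/n\mathbb{Z}$. A path of length $m$ is a sequence $\langle v_0,\dots,v_m\rangle$ of vertices with edges $v_{i-1}\to v_i$; a subpath is $\langle v_i,\dots,v_j\rangle$ for $0\le i<j\le m$. $Y_m(n)$ is the set of paths of length $m$ in $\mathscr{E}_n$ with initial vertex $1/0$ and final vertex $-1/0$. -}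

module Defs where

open import Data.Nat as ℕ using (ℕ; zero; suc; _≤_; _<_; s≤s)
open import Data.Nat.Properties using (≤-trans; m≤n+m; n≤1+n)
open import Data.Nat.GCD using (gcd)
open import Data.Fin using (Fin; toℕ; fromℕ; fromℕ<; inject₁)
open import Data.Integer as ℤ using (ℤ; +_; _-_; _*_; -_)
open import Data.Integer.Divisibility using (_∣_)
open import Data.Product using (Σ; _×_; _,_; proj₁; proj₂)
open import Relation.Binary.PropositionalEquality using (_≡_)
open import Relation.Nullary using (¬_)

-- Z/nZ is represented by Fin n (canonical representatives 0..n-1).
-- Congruence of integers modulo n.
_≡_[mod_] : ℤ → ℤ → ℕ → Set
x ≡ y [mod n ] = (+ n) ∣ (x - y)

⟦_⟧ : {n : ℕ} → Fin n → ℤ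
⟦ a ⟧ = + toℕ a

-- Vertices of E_n: pairs (a,b) generating the unit ideal, i.e. gcd(a,b,n)=1.
Vertex : ℕ → Set
Vertex n = Σ (Fin n × Fin n) λ ab →
  gcd (gcd (toℕ (proj₁ ab)) (toℕ (proj₂ ab))) n ≡ 1

num den : {n : ℕ} → Vertex n → Fin n
num v = proj₁ (proj₁ v)
den v = proj₂ (proj₁ v)

infix 4 _≅_/_ _≡_[mod_]
_≅_/_ : {n : ℕ} → Vertex n → ℤ → ℤ → Set
_≅_/_ {n} v x y = (⟦ num v ⟧ ≡ x [mod n ]) × (⟦ den v ⟧ ≡ y [mod n ])

Edge : {n : ℕ} → Vertex n → Vertex n → Set
Edge {n} u v = (⟦ num u ⟧ * ⟦ den v ⟧ - ⟦ den u ⟧ * ⟦ num v ⟧) ≡ + 1 [mod n ]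

IsPath : {n : ℕ} (m : ℕ) → (Fin (suc m) → Vertex n) → Set
IsPath m γ = (i : Fin m) → Edge (γ (inject₁ i)) (γ (Data.Fin.suc i))

InY : (m n : ℕ) → (Fin (suc m) → Vertex n) → Set
InY m n γ = IsPath m γ × (γ Data.Fin.zero ≅ (+ 1) / (+ 0)) × (γ (fromℕ m) ≅ (- (+ 1)) / (+ 0))

idx0 idx1 idx2 : {m : ℕ} (i : ℕ) → 2 ℕ.+ i ≤ m → Fin (suc m)
idx0 i h = fromℕ< {i} (s≤s (≤-trans (m≤n+m i 2) h))
idx1 i h = fromℕ< {suc i} (s≤s (≤-trans (n≤1+n (suc i)) h))
idx2 i h = fromℕ< {suc (suc i)} (s≤s h)

-- γ has a subpath ⟨a/b, c/1, -1/0⟩ or ⟨a/b, c/-1, 1/0⟩ with b ≠ 0.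
-- (The edges of the subpath are automatic since γ is a path.)
HasSpecialSubpath : {n m : ℕ} → (Fin (suc m) → Vertex n) → Set
HasSpecialSubpath {n} {m} γ = Σ ℕ λ i → Σ (2 ℕ.+ i ≤ m) λ h →
  (¬ (⟦ den (γ (idx0 i h)) ⟧ ≡ + 0 [mod n ])) ×
  (  ((⟦ den (γ (idx1 i h)) ⟧ ≡ + 1 [mod n ]) × (γ (idx2 i h) ≅ (- (+ 1)) / (+ 0)))
   Data.Sum.⊎
     ((⟦ den (γ (idx1 i h)) ⟧ ≡ - (+ 1) [mod n ]) × (γ (idx2 i h) ≅ (+ 1) / (+ 0))))
  where import Data.Sum

{-# OPTIONS --safe #-}
-- Walk backwards from the final vertex -1/0. An edge a/b → ±1/0 forces b ≡ ∓1, and if the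
-- vertex two steps before ±1/0 has denominator 0, the edge leaving it forces it to be ∓1/0.
-- So unless a special subpath occurs, the vertices at positions m, m-2, m-4, … are
-- -1/0, 1/0, -1/0, …. For odd m this reaches position 1, and the edge 1/0 → ±1/0 would give
-- 1 ≡ 0; for 4 ∣ m it reaches position 0 as -1/0, which is not 1/0 when p ≠ 2.
module Submission where

open import Defs
open import Data.Nat using (ℕ; suc; NonZero)
open import Data.Nat.Divisibility using (_∣_)
open import Data.Nat.Primality using (Prime)
open import Data.Fin using (Fin)
open import Data.Sum using (_⊎_)
open import Data.Product using (_×_)
open import Relation.Nullary using (¬_)
open import Relation.Binary.PropositionalEquality using (_≢_)

open import Data.Nat using (zero; _≤_; s≤s)
open import Data.Nat.Properties using (≤-reflexive; <⇒≤; m+n≤o⇒n≤o; +-comm; +-identityʳ; *-assoc)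
open import Data.Nat.GeneralisedArithmetic using (iterate)
open import Data.Nat.DivMod using (_%_; _/_; m≡m%n+[m/n]*n; m%n<n)
open import Data.Nat.Divisibility using (divides; _∣?_; _∣0; ∣1⇒≡1)
open import Data.Nat.Primality using (¬prime[1]; prime[2]; prime⇒irreducible)
open import Data.Fin using (fromℕ; fromℕ<; inject₁)
open import Data.Fin.Properties using (fromℕ-def; toℕ-injective; toℕ-inject₁; toℕ-fromℕ<)
import Data.Integer as ℤ
open import Data.Integer using (ℤ; 0ℤ; 1ℤ; -1ℤ; _-_; -_; _◃_; ∣_∣)
open import Data.Integer.Properties using (+-inverseʳ; ∣i-j∣≡∣j-i∣; *-identityʳ)
import Data.Integer.Divisibility.Signed as Signed
open import Data.Integer.Tactic.RingSolver using (solve-∀)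
import Data.Sign as Sign
open import Data.Sign using (opposite)
open import Data.Sign.Properties using (opposite-involutive)
open import Data.Sum using (inj₁; inj₂; [_,_]′)
open import Data.Product using (∃; _,_; proj₁; proj₂)
open import Function using (_∘_)
open import Relation.Nullary using (Dec; yes; no; contradiction)
open import Relation.Binary.Bundles using (Setoid)
open import Relation.Binary.PropositionalEquality
  using (_≡_; refl; sym; trans; cong; subst)

module _ {n : ℕ} where
  open import Data.Integer using (_+_; _*_)

  private
    toSigned : ∀ {x y} → x ≡ y [mod n ] → (ℤ.+ n) Signed.∣ x - y
    toSigned = Signed.∣ᵤ⇒∣

    fromSigned : ∀ {x y} → (ℤ.+ n) Signed.∣ x - y → x ≡ y [mod n ]
    fromSigned = Signed.∣⇒∣ᵤ

    divides-≡ : ∀ {a b} → a ≡ b → (ℤ.+ n) Signed.∣ a → (ℤ.+ n) Signed.∣ b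
    divides-≡ = subst ((ℤ.+ n) Signed.∣_)

  ≡-mod-reflexive : ∀ {x y} → x ≡ y → x ≡ y [mod n ]
  ≡-mod-reflexive {x} refl = subst (λ z → n ∣ ∣ z ∣) (sym (+-inverseʳ x)) (n ∣0)

  ≡-mod-sym : ∀ {x y} → x ≡ y [mod n ] → y ≡ x [mod n ]
  ≡-mod-sym {x} {y} = subst (n ∣_) (∣i-j∣≡∣j-i∣ x y)

  ≡-mod-trans : ∀ {x y z} → x ≡ y [mod n ] → y ≡ z [mod n ] → x ≡ z [mod n ]
  ≡-mod-trans {x} {y} {z} x≡y y≡z = fromSigned {x} {z} (divides-≡ (telescope x y z)
    (Signed.∣m∣n⇒∣m+n (toSigned {x} {y} x≡y) (toSigned {y} {z} y≡z)))
    where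
    telescope : ∀ x y z → (x - y) + (y - z) ≡ x - z
    telescope = solve-∀

  *-congˡ-mod : ∀ a {x y} → x ≡ y [mod n ] → a * x ≡ a * y [mod n ]
  *-congˡ-mod a {x} {y} x≡y = fromSigned {a * x} {a * y}
    (divides-≡ (sym (*-distribˡ-minus a x y)) (Signed.∣n⇒∣m*n a (toSigned {x} {y} x≡y)))
    where
    *-distribˡ-minus : ∀ a x y → a * x - a * y ≡ a * (x - y)
    *-distribˡ-minus = solve-∀

  *-congʳ-mod : ∀ a {x y} → x ≡ y [mod n ] → x * a ≡ y * a [mod n ]
  *-congʳ-mod a {x} {y} x≡y = fromSigned {x * a} {y * a}
    (divides-≡ (sym (*-distribʳ-minus a x y)) (Signed.∣m⇒∣m*n a (toSigned {x} {y} x≡y)))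
    where
    *-distribʳ-minus : ∀ a x y → x * a - y * a ≡ (x - y) * a
    *-distribʳ-minus = solve-∀

  minus-congˡ-mod : ∀ a {x y} → x ≡ y [mod n ] → a - x ≡ a - y [mod n ]
  minus-congˡ-mod a {x} {y} x≡y = fromSigned {a - x} {a - y}
    (divides-≡ (cancel a x y) (toSigned {y} {x} (≡-mod-sym {x} {y} x≡y)))
    where
    cancel : ∀ a x y → y - x ≡ (a - x) - (a - y)
    cancel = solve-∀

  minus-congʳ-mod : ∀ a {x y} → x ≡ y [mod n ] → x - a ≡ y - a [mod n ]
  minus-congʳ-mod a {x} {y} x≡y = fromSigned {x - a} {y - a}
    (divides-≡ (cancel a x y) (toSigned {x} {y} x≡y))
    where
    cancel : ∀ a x y → x - y ≡ (x - a) - (y - a)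
    cancel = solve-∀

  ≡1∧≡-1⇒∣2 : ∀ x → x ≡ 1ℤ [mod n ] → x ≡ -1ℤ [mod n ] → n ∣ 2
  ≡1∧≡-1⇒∣2 x x≡1 x≡-1 = ≡-mod-trans {1ℤ} {x} { -1ℤ} (≡-mod-sym {x} x≡1) x≡-1

  ≡-mod-dec : ∀ x y → Dec (x ≡ y [mod n ])
  ≡-mod-dec x y = n ∣? ∣ x - y ∣

  ≡-mod-setoid : Setoid _ _
  ≡-mod-setoid = record
    { _≈_           = _≡_[mod n ]
    ; isEquivalence = record
      { refl  = λ {x} → ≡-mod-reflexive {x} refl
      ; sym   = λ {x} {y} → ≡-mod-sym {x} {y}
      ; trans = λ {x} {y} {z} → ≡-mod-trans {x} {y} {z}
      }
    }

  open import Relation.Binary.Reasoning.Setoid ≡-mod-setoid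

  -- In the names below, a/b → c/d is an edge (a d - b c ≡ 1) and ∞ means denominator 0.
  -- The sides of a congruence cannot be inferred (it unfolds to divisibility of their
  -- difference), hence the explicit arguments.
  edge-into-∞⇒b≡-e : ∀ a b c d e → e * e ≡ 1ℤ → a * d - b * c ≡ 1ℤ [mod n ] →
                     c ≡ e [mod n ] → d ≡ 0ℤ [mod n ] → b ≡ - e [mod n ]
  edge-into-∞⇒b≡-e a b c d e e²≡1 ad-bc≡1 c≡e d≡0 = begin
    b                        ≡⟨ *-identityʳ b ⟨
    b * 1ℤ                   ≡⟨ cong (b *_) e²≡1 ⟨
    b * (e * e)              ≡⟨ expand a b e ⟨
    - e * (a * 0ℤ - b * e)   ≈⟨ *-congˡ-mod (- e) (minus-congˡ-mod (a * 0ℤ) (*-congˡ-mod b c≡e)) ⟨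
    - e * (a * 0ℤ - b * c)   ≈⟨ *-congˡ-mod (- e) (minus-congʳ-mod (b * c) {a * d} {a * 0ℤ}
                                                       (*-congˡ-mod a {d} {0ℤ} d≡0)) ⟨
    - e * (a * d - b * c)    ≈⟨ *-congˡ-mod (- e) ad-bc≡1 ⟩
    - e * 1ℤ                 ≡⟨ *-identityʳ (- e) ⟩
    - e                      ∎
    where
    expand : ∀ a b e → - e * (a * 0ℤ - b * e) ≡ b * (e * e)
    expand = solve-∀

  edge-out-of-∞⇒a≡e : ∀ a b c d e → e * e ≡ 1ℤ → a * d - b * c ≡ 1ℤ [mod n ] →
                      b ≡ 0ℤ [mod n ] → d ≡ e [mod n ] → a ≡ e [mod n ]
  edge-out-of-∞⇒a≡e a b c d e e²≡1 ad-bc≡1 b≡0 d≡e = begin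
    a                        ≡⟨ *-identityʳ a ⟨
    a * 1ℤ                   ≡⟨ cong (a *_) e²≡1 ⟨
    a * (e * e)              ≡⟨ expand a c e ⟨
    e * (a * e - 0ℤ * c)     ≈⟨ *-congˡ-mod e (minus-congˡ-mod (a * e) {b * c} {0ℤ * c}
                                                   (*-congʳ-mod c {b} {0ℤ} b≡0)) ⟨
    e * (a * e - b * c)      ≈⟨ *-congˡ-mod e (minus-congʳ-mod (b * c) {a * d} {a * e}
                                                   (*-congˡ-mod a d≡e)) ⟨
    e * (a * d - b * c)      ≈⟨ *-congˡ-mod e ad-bc≡1 ⟩
    e * 1ℤ                   ≡⟨ *-identityʳ e ⟩
    e                        ∎
    where
    expand : ∀ a c e → e * (a * e - 0ℤ * c) ≡ a * (e * e)
    expand = solve-∀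

  edge-within-∞⇒1≡0 : ∀ a b c d → a * d - b * c ≡ 1ℤ [mod n ] →
                      b ≡ 0ℤ [mod n ] → d ≡ 0ℤ [mod n ] → 1ℤ ≡ 0ℤ [mod n ]
  edge-within-∞⇒1≡0 a b c d ad-bc≡1 b≡0 d≡0 = begin
    1ℤ                       ≈⟨ ad-bc≡1 ⟨
    a * d - b * c            ≈⟨ minus-congʳ-mod (b * c) {a * d} {a * 0ℤ} (*-congˡ-mod a {d} {0ℤ} d≡0) ⟩
    a * 0ℤ - b * c           ≈⟨ minus-congˡ-mod (a * 0ℤ) {b * c} {0ℤ * c} (*-congʳ-mod c {b} {0ℤ} b≡0) ⟩
    a * 0ℤ - 0ℤ * c          ≡⟨ vanish a c ⟩
    0ℤ                       ∎
    where
    vanish : ∀ a c → a * 0ℤ - 0ℤ * c ≡ 0ℤ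
    vanish = solve-∀

◃1-square : ∀ s → (s ◃ 1) ℤ.* (s ◃ 1) ≡ 1ℤ
◃1-square Sign.- = refl
◃1-square Sign.+ = refl

-◃1≡opposite◃1 : ∀ s → - (s ◃ 1) ≡ opposite s ◃ 1
-◃1≡opposite◃1 Sign.- = refl
-◃1≡opposite◃1 Sign.+ = refl

open import Data.Nat using (_+_; _*_)

iterate-involutive-even : ∀ {A : Set} {f : A → A} → (∀ x → f (f x) ≡ x) →
                          ∀ q x → iterate f x (q * 2) ≡ x
iterate-involutive-even f-inv zero    x = refl
iterate-involutive-even {f = f} f-inv (suc q) x =
  trans (cong (λ y → iterate f y (q * 2)) (f-inv x)) (iterate-involutive-even f-inv q x)

odd⇒≡[k*2]+1 : ∀ m → ¬ (2 ∣ m) → ∃ λ k → k * 2 + 1 ≡ m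
odd⇒≡[k*2]+1 m 2∤m with m % 2 | m%n<n m 2 | m≡m%n+[m/n]*n m 2
... | 0           | _             | m≡[m/2]*2   = contradiction (divides (m / 2) m≡[m/2]*2) 2∤m
... | 1           | _             | m≡1+[m/2]*2 = m / 2 , trans (+-comm (m / 2 * 2) 1) (sym m≡1+[m/2]*2)
... | suc (suc _) | s≤s (s≤s ()) | _

prime∤1 : ∀ {p} → Prime p → ¬ (p ∣ 1)
prime∤1 p-prime p∣1 = ¬prime[1] (subst Prime (∣1⇒≡1 p∣1) p-prime)

prime∣2⇒≡2 : ∀ {p} → Prime p → p ∣ 2 → p ≡ 2
prime∣2⇒≡2 p-prime p∣2 with prime⇒irreducible prime[2] p∣2
... | inj₁ refl = contradiction p-prime ¬prime[1]
... | inj₂ p≡2  = p≡2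

module BackwardWalk {n m : ℕ} (γ : Fin (suc m) → Vertex n) (path : IsPath m γ) where

  vertex : (j : ℕ) → .(j ≤ m) → Vertex n
  vertex j j≤m = γ (fromℕ< (s≤s j≤m))

  edge : ∀ j .(j<m : suc j ≤ m) → Edge (vertex j (<⇒≤ j<m)) (vertex (suc j) j<m)
  edge j j<m = subst (λ i → Edge (γ i) (vertex (suc j) j<m)) inject₁-fromℕ< (path (fromℕ< j<m))
    where
    inject₁-fromℕ< : inject₁ (fromℕ< j<m) ≡ fromℕ< (s≤s (<⇒≤ j<m))
    inject₁-fromℕ< =
      toℕ-injective (trans (toℕ-inject₁ _) (trans (toℕ-fromℕ< j<m) (sym (toℕ-fromℕ< _))))

  vertex-at-m : ∀ {i} (i≡m : i ≡ m) → vertex i (≤-reflexive i≡m) ≡ γ (fromℕ m)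
  vertex-at-m refl = cong γ (sym (fromℕ-def m))

  den-before-±1/0 : ∀ s j (h : suc j ≤ m) → vertex (suc j) h ≅ s ◃ 1 / 0ℤ →
                    ⟦ den (vertex j (<⇒≤ h)) ⟧ ≡ opposite s ◃ 1 [mod n ]
  den-before-±1/0 s j h (num-v≡s , den-v≡0) =
    subst (λ t → ⟦ den u ⟧ ≡ t [mod n ]) (-◃1≡opposite◃1 s)
      (edge-into-∞⇒b≡-e ⟦ num u ⟧ ⟦ den u ⟧ ⟦ num v ⟧ ⟦ den v ⟧ (s ◃ 1) (◃1-square s)
                        (edge j h) num-v≡s den-v≡0)
    where
    u v : Vertex n
    u = vertex j (<⇒≤ h)
    v = vertex (suc j) h

  ∞-before-den≡±1 : ∀ s j (h : suc j ≤ m) → ⟦ den (vertex j (<⇒≤ h)) ⟧ ≡ 0ℤ [mod n ] →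
                    ⟦ den (vertex (suc j) h) ⟧ ≡ s ◃ 1 [mod n ] → vertex j (<⇒≤ h) ≅ s ◃ 1 / 0ℤ
  ∞-before-den≡±1 s j h den-u≡0 den-v≡s =
    edge-out-of-∞⇒a≡e ⟦ num u ⟧ ⟦ den u ⟧ ⟦ num v ⟧ ⟦ den v ⟧ (s ◃ 1) (◃1-square s)
                      (edge j h) den-u≡0 den-v≡s
    , den-u≡0
    where
    u v : Vertex n
    u = vertex j (<⇒≤ h)
    v = vertex (suc j) h

  consecutive-∞⇒1≡0 : ∀ j (h : suc j ≤ m) → ⟦ den (vertex j (<⇒≤ h)) ⟧ ≡ 0ℤ [mod n ] →
                      ⟦ den (vertex (suc j) h) ⟧ ≡ 0ℤ [mod n ] → 1ℤ ≡ 0ℤ [mod n ]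
  consecutive-∞⇒1≡0 j h = edge-within-∞⇒1≡0 ⟦ num u ⟧ ⟦ den u ⟧ ⟦ num v ⟧ ⟦ den v ⟧ (edge j h)
    where
    u v : Vertex n
    u = vertex j (<⇒≤ h)
    v = vertex (suc j) h

  special-tail : ∀ s (u v : Vertex n) → ⟦ den u ⟧ ≡ opposite s ◃ 1 [mod n ] → v ≅ s ◃ 1 / 0ℤ →
                 ((⟦ den u ⟧ ≡ 1ℤ [mod n ]) × (v ≅ -1ℤ / 0ℤ)) ⊎ ((⟦ den u ⟧ ≡ -1ℤ [mod n ]) × (v ≅ 1ℤ / 0ℤ))
  special-tail Sign.- u v den-u≡1 v≅-1/0 = inj₁ (den-u≡1 , v≅-1/0)
  special-tail Sign.+ u v den-u≡-1 v≅1/0 = inj₂ (den-u≡-1 , v≅1/0)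

  step-back : ∀ s j (h : 2 + j ≤ m) → vertex (2 + j) h ≅ s ◃ 1 / 0ℤ →
              HasSpecialSubpath γ ⊎ (vertex j (m+n≤o⇒n≤o 2 h) ≅ opposite s ◃ 1 / 0ℤ)
  step-back s j h last≅s/0 with ≡-mod-dec {n} ⟦ den (vertex j (m+n≤o⇒n≤o 2 h)) ⟧ 0ℤ
  ... | yes den≡0 =
    inj₂ (∞-before-den≡±1 (opposite s) j (<⇒≤ h) den≡0 (den-before-±1/0 s (suc j) h last≅s/0))
  ... | no den≢0 =
    inj₁ (j , h , den≢0 , special-tail s (vertex (suc j) (<⇒≤ h)) (vertex (2 + j) h)
                                        (den-before-±1/0 s (suc j) h last≅s/0) last≅s/0)

  walk-back : ∀ k j s (h : k * 2 + j ≤ m) → vertex (k * 2 + j) h ≅ s ◃ 1 / 0ℤ →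
              HasSpecialSubpath γ ⊎ (vertex j (m+n≤o⇒n≤o (k * 2) h) ≅ iterate opposite s k ◃ 1 / 0ℤ)
  walk-back zero    j s h first≅s/0 = inj₂ first≅s/0
  walk-back (suc k) j s h first≅s/0 =
    [ inj₁ , walk-back k j (opposite s) (m+n≤o⇒n≤o 2 h) ]′ (step-back s (k * 2 + j) h first≅s/0)

  walk-back-from-end : ∀ k j s (eq : k * 2 + j ≡ m) → γ (fromℕ m) ≅ s ◃ 1 / 0ℤ →
                       HasSpecialSubpath γ ⊎
                       (vertex j (m+n≤o⇒n≤o (k * 2) (≤-reflexive eq)) ≅ iterate opposite s k ◃ 1 / 0ℤ)
  walk-back-from-end k j s eq last≅s/0 =
    walk-back k j s (≤-reflexive eq) (subst (_≅ s ◃ 1 / 0ℤ) (sym (vertex-at-m eq)) last≅s/0)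

  odd-length⇒special-subpath : ¬ (n ∣ 1) → ¬ (2 ∣ m) → γ Fin.zero ≅ 1ℤ / 0ℤ → γ (fromℕ m) ≅ -1ℤ / 0ℤ →
                               HasSpecialSubpath γ
  odd-length⇒special-subpath n∤1 2∤m first≅1/0 last≅-1/0
    with k , k*2+1≡m ← odd⇒≡[k*2]+1 m 2∤m
    with walk-back-from-end k 1 Sign.- k*2+1≡m last≅-1/0
  ... | inj₁ special = special
  ... | inj₂ second≅±1/0 =
    contradiction (consecutive-∞⇒1≡0 0 (m+n≤o⇒n≤o (k * 2) (≤-reflexive k*2+1≡m))
                                     (proj₂ first≅1/0) (proj₂ second≅±1/0))
                  n∤1

  4∣length⇒special-subpath : ¬ (n ∣ 2) → 4 ∣ m → γ Fin.zero ≅ 1ℤ / 0ℤ → γ (fromℕ m) ≅ -1ℤ / 0ℤ →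
                             HasSpecialSubpath γ
  4∣length⇒special-subpath n∤2 (divides q m≡q*4) first≅1/0 last≅-1/0
    with walk-back-from-end (q * 2) 0 Sign.- (trans (+-identityʳ _) (trans (*-assoc q 2 2) (sym m≡q*4)))
                            last≅-1/0
  ... | inj₁ special = special
  ... | inj₂ first≅±1/0 = contradiction (≡1∧≡-1⇒∣2 ⟦ num (γ Fin.zero) ⟧ (proj₁ first≅1/0) first≅-1) n∤2
    where
    first≅-1 : ⟦ num (γ Fin.zero) ⟧ ≡ -1ℤ [mod n ]
    first≅-1 = subst (λ s → ⟦ num (γ Fin.zero) ⟧ ≡ s ◃ 1 [mod n ])
                 (iterate-involutive-even opposite-involutive q Sign.-) (proj₁ first≅±1/0)

open BackwardWalk using (odd-length⇒special-subpath; 4∣length⇒special-subpath)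

lemma6 : (p m : ℕ) → Prime p → NonZero m →
    ((¬ (2 ∣ m)) ⊎ ((4 ∣ m) × (p ≢ 2))) →
    (γ : Fin (suc m) → Vertex p) → InY m p γ → HasSpecialSubpath γ
lemma6 p m p-prime _ (inj₁ 2∤m) γ (path , first≅1/0 , last≅-1/0) =
  odd-length⇒special-subpath γ path (prime∤1 p-prime) 2∤m first≅1/0 last≅-1/0
lemma6 p m p-prime _ (inj₂ (4∣m , p≢2)) γ (path , first≅1/0 , last≅-1/0) =
  4∣length⇒special-subpath γ path (p≢2 ∘ prime∣2⇒≡2 p-prime) 4∣m first≅1/0 last≅-1/0
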